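{- Let $G$ be an embedded graph that is orientable (embedded in an orientable surface) and checkerboard colourable (its faces can be coloured black and white so that faces sharing an edge receive different colours). Then for every Penrose state $s$ of the medial graph $G_m$, \[ cr(s)+c(s)\equiv f(G) \pmod 2, \] where $f(G)$ is the number of faces of $G$.
   Context: The medial graph $G_m$ of an embedded graph $G$ has a degree-4 vertex $v_e$ on each edge $e$ of $G$, with edges following the face boundaries of $G$ (an isolated vertex of $G$ contributes a vertex-free closed curve); $G_m$ lies in the same surface. Its canonical checkerboard colouring colours a face of $G_m$ black if it contains a vertex of $G$, white otherwise. At $v_e$ there are three vertex states: the white split (half-edges paired so each pair is consecutive and bounds a white corner), the black split (same with black corners), and the crossing (opposite half-edges paired). A graph state $s$ chooses a vertex state at each vertex; $c(s)$ is the number of resulting closed curves and $cr(s)$ the number of crossing vertex states. A Penrose state is a state with no black splits. -}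

module Defs where

open import Data.Nat using (ℕ; zero; suc; _+_; _*_; _≤ᵇ_)
open import Data.Fin using (Fin; toℕ)
open import Data.Fin.Base using () renaming (zero to fzero)
open import Data.Bool using (Bool; true; false; not; _∧_; if_then_else_)
open import Data.Product using (_×_; _,_)
open import Data.List using (List; []; _∷_; length; filterᵇ; map; upTo; concatMap; allFin)
open import Function.Bundles using (_↔_; Inverse)
open import Relation.Binary.PropositionalEquality using (_≡_; _≢_)

allᵇ : {A : Set} → (A → Bool) → List A → Bool
allᵇ p []       = true
allᵇ p (x ∷ xs) = p x ∧ allᵇ p xs

iter : {A : Set} → (A → A) → ℕ → A → A
iter f zero    x = x
iter f (suc k) x = f (iter f k x)

-- Number of cycles of a permutation f of a finite type, enumerated by
-- 'enum' (each element exactly once) with injective index 'idx':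
-- count the elements with the least index in their f-orbit.
countCycles : {A : Set} → List A → (A → ℕ) → (A → A) → ℕ
countCycles enum idx f = length (filterᵇ isMin enum)
  where
  isMin : _ → Bool
  isMin x = allᵇ (λ k → idx x ≤ᵇ idx (iter f k x)) (upTo (length enum))

-- Number of classes of the equivalence relation generated by two
-- involutions τ and π (the orbits of the group ⟨τ , π⟩): an orbit of x is
-- { (π∘τ)^k x } ∪ { τ ((π∘τ)^k x) }; count elements of least index in it.
countClasses : {A : Set} → List A → (A → ℕ) → (A → A) → (A → A) → ℕ
countClasses enum idx τ π = length (filterᵇ isMin enum)
  where
  f : _ → _
  f x = π (τ x)
  isMin : _ → Bool
  isMin x = allᵇ (λ k → (idx x ≤ᵇ idx (iter f k x)) ∧ (idx x ≤ᵇ idx (τ (iter f k x))))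
                (upTo (length enum))

-- Embedded graphs in orientable surfaces, as rotation systems
-- (oriented combinatorial maps), plus a number of isolated vertices.
-- Edges are Fin nE; each edge e has two darts (half-edges) (e , false)
-- and (e , true); the edge involution α swaps them.  σ is the rotation
-- (cyclic order of darts around each vertex, given by the orientation).
-- Vertices = cycles of σ, faces = cycles of φ = σ ∘ α.

Dart : ℕ → Set
Dart m = Fin m × Bool

α : {m : ℕ} → Dart m → Dart m
α (e , b) = (e , not b)

record OrientableEmbeddedGraph : Set where
  field
    nE   : ℕ
    nIso : ℕ
    σ    : Dart nE ↔ Dart nE

  rot : Dart nE → Dart nE
  rot = Inverse.to σ

  rot⁻¹ : Dart nE → Dart nE
  rot⁻¹ = Inverse.from σ

  φ : Dart nE → Dart nE
  φ d = rot (α d)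

  darts : List (Dart nE)
  darts = concatMap (λ e → (e , false) ∷ (e , true) ∷ []) (allFin nE)

  dartIdx : Dart nE → ℕ
  dartIdx (e , b) = 2 * toℕ e + (if b then 1 else 0)

open OrientableEmbeddedGraph public

-- f(G): number of faces (each isolated vertex is its own sphere
-- component with exactly one face).
numFaces : OrientableEmbeddedGraph → ℕ
numFaces G = countCycles (darts G) (dartIdx G) (φ G) + nIso G

-- Checkerboard colourable: a colouring of faces (a colour for each dart,
-- constant along face cycles) such that the two faces on either side of
-- every edge (those of the darts d and α d) get different colours.
CheckerboardColourable : OrientableEmbeddedGraph → Set
CheckerboardColourable G =
  Data.Product.Σ (Dart (nE G) → Bool) λ col →
    ((d : Dart (nE G)) → col (φ G d) ≡ col d) ×
    ((d : Dart (nE G)) → col (α d) ≢ col d)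

-- Its vertex v_e sits on edge e; its edges are the
-- corners of G: the corner c (between dart c and rot c at a vertex) is a
-- medial edge from v_{edge c} to v_{edge (rot c)}.  Half-edges of G_m are
-- pairs (d , side): at dart d of edge e, (d , R) is the end of corner d and
-- (d , L) is the end of corner rot⁻¹ d.  The black corner at v_e next to
-- dart d (containing the vertex of G at d) is bounded by (d,R),(d,L); the
-- white corners (in faces of G) are bounded by (d,R),(α d,L) and
-- (d,L),(α d,R).

data Side : Set where
  R L : Side

HalfEdge : ℕ → Set
HalfEdge m = Dart m × Side

data VState : Set where
  white black cross : VState

GState : OrientableEmbeddedGraph → Set
GState G = Fin (nE G) → VState

medialEdge : (G : OrientableEmbeddedGraph) → HalfEdge (nE G) → HalfEdge (nE G)
medialEdge G (c , R) = (rot G c , L)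
medialEdge G (c , L) = (rot⁻¹ G c , R)

statePair : (G : OrientableEmbeddedGraph) → GState G → HalfEdge (nE G) → HalfEdge (nE G)
statePair G s ((e , b) , side) with s e
... | white = (α (e , b) , flip side)
  where
  flip : Side → Side
  flip R = L
  flip L = R
... | black = ((e , b) , flip side)
  where
  flip : Side → Side
  flip R = L
  flip L = R
... | cross = (α (e , b) , side)

halfEdges : (G : OrientableEmbeddedGraph) → List (HalfEdge (nE G))
halfEdges G = concatMap (λ d → (d , R) ∷ (d , L) ∷ []) (darts G)

halfIdx : (G : OrientableEmbeddedGraph) → HalfEdge (nE G) → ℕ
halfIdx G (d , R) = 2 * dartIdx G d
halfIdx G (d , L) = 2 * dartIdx G d + 1

-- c(s): number of closed curves of the state: the classes of half-edges
-- connected by medial edges and state pairings, plus one vertex-free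
-- closed curve for each isolated vertex of G.
numCurves : (G : OrientableEmbeddedGraph) → GState G → ℕ
numCurves G s = countClasses (halfEdges G) (halfIdx G) (medialEdge G) (statePair G s) + nIso G

isCross : VState → Bool
isCross cross = true
isCross _     = false

numCross : (G : OrientableEmbeddedGraph) → GState G → ℕ
numCross G s = length (filterᵇ (λ e → isCross (s e)) (allFin (nE G)))

Penrose : (G : OrientableEmbeddedGraph) → GState G → Set
Penrose G s = (e : Fin (nE G)) → s e ≢ black

-- Colour each half-edge of G_m by the colour, in a checkerboard colouring of G,
-- of the face of the dart carrying it. Medial edges always change this colour, and
-- so do the pairings of a Penrose state, since white splits and crossings both pass
-- to the other dart of the edge. Hence every curve of the state alternates in
-- colour and is traced, on its white half-edges, by one cycle of a permutation of
-- these. For the all-white state that permutation has one cycle per face of G.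
-- Switching a crossing to a white split composes the permutation with a
-- transposition, which changes the number of cycles by exactly one while cr drops
-- by one, so cr(s) + c(s) has the parity of the all-white state, which is f(G).
-- Isolated vertices add one to both c(s) and f(G).
module Submission where

open import Defs
open import Data.Bool using (Bool; true; false; not; T; if_then_else_; _∧_)
open import Data.Bool.Properties using (T-∧; not-involutive; ¬-not)
open import Data.Empty using (⊥; ⊥-elim)
open import Data.Unit using (tt)
open import Data.Fin using (Fin; toℕ; zero; suc; remQuot; combine)
open import Data.Fin.Properties using (pigeonhole; toℕ<n; toℕ-injective; remQuot-combine; combine-remQuot; toℕ-combine; 2↔Bool)
  renaming (_≟_ to _≟ᶠ_; suc-injective to suc-injectiveᶠ)
open import Data.List using (List; []; _∷_; length; filterᵇ; tabulate; upTo; applyUpTo; _++_; concatMap)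
open import Data.List.Extrema.Nat using (argmin; argmin-sel; f[argmin]≤f[xs])
open import Data.List.Membership.Propositional using (_∈_)
open import Data.List.Membership.Propositional.Properties using (∈-applyUpTo⁻; ∈-++⁻)
open import Data.List.Properties using (length-tabulate)
open import Data.List.Relation.Unary.All using (All; []; _∷_)
open import Data.List.Relation.Unary.All.Properties using (applyUpTo⁻; applyUpTo⁺₁; ++⁻)
open import Data.Nat using (ℕ; zero; suc; _+_; _*_; _∸_; _≤_; _<_; _≤ᵇ_; _%_; _/_; z≤n; s≤s; z<s; >-nonZero)
open import Data.Nat.DivMod using (m≡m%n+[m/n]*n; m%n<n; [m+n]%n≡m%n; %-distribˡ-+)
open import Data.Nat.Induction using (<-rec)
open import Data.Nat.Properties
  using ( ≤-antisym; ≤-refl; ≤-trans; ≤-total; ≤-pred; <⇒≤; <-≤-trans; ≤-<-trans; <-trans; n<1+n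
        ; m<n⇒m<1+n; m≤n⇒m<n∨m≡n; m<n⇒0<n∸m; m∸n≤m; m+[n∸m]≡n; +-comm; +-suc; +-assoc; *-comm
        ; +-identityʳ; suc-injective; ≤ᵇ⇒≤; ≤⇒≤ᵇ; anyUpTo?; _<?_; module ≤-Reasoning )
open import Data.Product using (Σ-syntax; _×_; _,_; proj₁; proj₂)
open import Data.Sum using (_⊎_; inj₁; inj₂; swap)
open import Function using (id; _∘_; case_of_; Equivalence)
open import Function.Bundles using (_↔_; Inverse; mk↔ₛ′)
open import Relation.Binary.PropositionalEquality hiding (isEquivalence)
open import Relation.Binary.Structures using (IsEquivalence)
open import Relation.Nullary using (¬_; Dec; yes; no; does; _×-dec_; _⊎-dec_)
open import Relation.Nullary.Decidable using (T?)
open import Relation.Unary using (Decidable)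

private variable
  A : Set
  m n : ℕ

-- Counting subsets of Fin n

count : (Fin n → Bool) → ℕ
count {zero}  p = 0
count {suc n} p = if p zero then suc (count (p ∘ suc)) else count (p ∘ suc)

T-⇔⇒≡ : {a b : Bool} → (T a → T b) → (T b → T a) → a ≡ b
T-⇔⇒≡ {false} {false} _ _ = refl
T-⇔⇒≡ {false} {true}  _ g = ⊥-elim (g tt)
T-⇔⇒≡ {true}  {false} f _ = ⊥-elim (f tt)
T-⇔⇒≡ {true}  {true}  _ _ = refl

count-cong : (p q : Fin n → Bool) → (∀ x → p x ≡ q x) → count p ≡ count q
count-cong {zero}  p q eq = refl
count-cong {suc n} p q eq rewrite eq zero with q zero
... | true  = cong suc (count-cong (p ∘ suc) (q ∘ suc) (eq ∘ suc))
... | false = count-cong (p ∘ suc) (q ∘ suc) (eq ∘ suc)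

length-filterᵇ-tabulate : (f : Fin n → A) (p : A → Bool) →
                          length (filterᵇ p (tabulate f)) ≡ count (p ∘ f)
length-filterᵇ-tabulate {zero}  f p = refl
length-filterᵇ-tabulate {suc n} f p with p (f zero)
... | true  = cong suc (length-filterᵇ-tabulate (f ∘ suc) p)
... | false = length-filterᵇ-tabulate (f ∘ suc) p

count-head-true : (p : Fin (suc n) → Bool) → T (p zero) → count p ≡ suc (count (p ∘ suc))
count-head-true p pz with p zero
... | true = refl

count-head-false : (p : Fin (suc n) → Bool) → ¬ T (p zero) → count p ≡ count (p ∘ suc)
count-head-false p ¬pz with p zero
... | true  = ⊥-elim (¬pz tt)
... | false = refl

⊆-agrees-outside : (p q : Fin n → Bool) (z : Fin n) → (∀ x → T (p x) → T (q x)) →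
               (∀ x → T (q x) → ¬ T (p x) → x ≡ z) → ∀ x → x ≢ z → p x ≡ q x
⊆-agrees-outside p q z p⊆q only-z x x≢z with T? (p x)
... | yes px = T-⇔⇒≡ (p⊆q x) (λ _ → px)
... | no ¬px = T-⇔⇒≡ (p⊆q x) (λ qx → ⊥-elim (x≢z (only-z x qx ¬px)))

count-insert : (p q : Fin n → Bool) (z : Fin n) →
               (∀ x → T (p x) → T (q x)) → T (q z) → ¬ T (p z) →
               (∀ x → T (q x) → ¬ T (p x) → x ≡ z) → count q ≡ suc (count p)
count-insert {suc n} p q zero p⊆q qz ¬pz only-z = begin
  count q                ≡⟨ count-head-true q qz ⟩
  suc (count (q ∘ suc))  ≡⟨ cong suc (count-cong _ _ λ x → sym (⊆-agrees-outside p q zero p⊆q only-z (suc x) λ ())) ⟩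
  suc (count (p ∘ suc))  ≡⟨ cong suc (sym (count-head-false p ¬pz)) ⟩
  suc (count p)          ∎
  where open ≡-Reasoning
count-insert {suc n} p q (suc z) p⊆q qz ¬pz only-z =
  same-head (⊆-agrees-outside p q (suc z) p⊆q only-z zero λ ())
    (count-insert (p ∘ suc) (q ∘ suc) z (p⊆q ∘ suc) qz ¬pz
                  λ x qx ¬px → suc-injectiveᶠ (only-z (suc x) qx ¬px))
  where
  same-head : p zero ≡ q zero → count (q ∘ suc) ≡ suc (count (p ∘ suc)) → count q ≡ suc (count p)
  same-head p0≡q0 tail rewrite p0≡q0 with q zero
  ... | true  = cong suc tail
  ... | false = tail

remove : Fin n → (Fin n → Bool) → Fin n → Bool
remove y₀ q y = if does (y ≟ᶠ y₀) then false else q y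

count-remove : (q : Fin n → Bool) (y₀ : Fin n) → T (q y₀) → count q ≡ suc (count (remove y₀ q))
count-remove q y₀ qy₀ = count-insert (remove y₀ q) q y₀ removed⊆ qy₀ y₀-removed only-y₀
  where
  removed⊆ : ∀ y → T (remove y₀ q y) → T (q y)
  removed⊆ y r with y ≟ᶠ y₀
  ... | no _ = r
  y₀-removed : ¬ T (remove y₀ q y₀)
  y₀-removed with y₀ ≟ᶠ y₀
  ... | yes _ = λ ()
  ... | no y₀≢y₀ = ⊥-elim (y₀≢y₀ refl)
  only-y₀ : ∀ y → T (q y) → ¬ T (remove y₀ q y) → y ≡ y₀
  only-y₀ y qy ¬r with y ≟ᶠ y₀
  ... | yes y≡y₀ = y≡y₀
  ... | no _ = ⊥-elim (¬r qy)

injection⇒count-≤ : (p : Fin m → Bool) (q : Fin n → Bool) (g : Fin m → Fin n) →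
             (∀ x → T (p x) → T (q (g x))) →
             (∀ x y → T (p x) → T (p y) → g x ≡ g y → x ≡ y) → count p ≤ count q
injection⇒count-≤ {zero}  p q g pq inj = z≤n
injection⇒count-≤ {suc m} p q g pq inj with T? (p zero)
... | no ¬p0 = begin
  count p          ≡⟨ count-head-false p ¬p0 ⟩
  count (p ∘ suc)  ≤⟨ injection⇒count-≤ (p ∘ suc) q (g ∘ suc) (pq ∘ suc) (λ x y px py e → suc-injectiveᶠ (inj _ _ px py e)) ⟩
  count q          ∎
  where open ≤-Reasoning
... | yes p0 = begin
  count p                           ≡⟨ count-head-true p p0 ⟩
  suc (count (p ∘ suc))             ≤⟨ s≤s (injection⇒count-≤ (p ∘ suc) (remove (g zero) q) (g ∘ suc) pq′ inj′) ⟩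
  suc (count (remove (g zero) q))   ≡⟨ sym (count-remove q (g zero) (pq zero p0)) ⟩
  count q                           ∎
  where
  open ≤-Reasoning
  inj′ : ∀ x y → T (p (suc x)) → T (p (suc y)) → g (suc x) ≡ g (suc y) → x ≡ y
  inj′ x y px py e = suc-injectiveᶠ (inj _ _ px py e)
  pq′ : ∀ x → T (p (suc x)) → T (remove (g zero) q (g (suc x)))
  pq′ x px with g (suc x) ≟ᶠ g zero
  ... | yes e = case inj (suc x) zero px p0 e of λ ()
  ... | no _  = pq (suc x) px

bijection⇒count-≡ : (p : Fin m → Bool) (q : Fin n → Bool) (g : Fin m → Fin n) (h : Fin n → Fin m) →
                  (∀ x → T (p x) → T (q (g x))) → (∀ y → T (q y) → T (p (h y))) →
                  (∀ x → T (p x) → h (g x) ≡ x) → (∀ y → T (q y) → g (h y) ≡ y) →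
                  count p ≡ count q
bijection⇒count-≡ p q g h pq qp hg gh = ≤-antisym
  (injection⇒count-≤ p q g pq λ x y px py e → trans (sym (hg x px)) (trans (cong h e) (hg y py)))
  (injection⇒count-≤ q p h qp λ x y qx qy e → trans (sym (gh x qx)) (trans (cong g e) (gh y qy)))

count≡suc⇒∃ : (p : Fin n → Bool) → count p ≡ suc m → Σ[ x ∈ Fin n ] T (p x)
count≡suc⇒∃ {suc n} p eq with T? (p zero)
... | yes p0 = zero , p0
... | no ¬p0 with count≡suc⇒∃ (p ∘ suc) (trans (sym (count-head-false p ¬p0)) eq)
...   | x , px = suc x , px

count≡0⇒¬ : (p : Fin n → Bool) → count p ≡ 0 → ∀ x → ¬ T (p x)
count≡0⇒¬ {suc n} p eq zero p0 = case trans (sym (count-head-true p p0)) eq of λ ()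
count≡0⇒¬ {suc n} p eq (suc x) with T? (p zero)
... | yes p0 = case trans (sym (count-head-true p p0)) eq of λ ()
... | no ¬p0 = count≡0⇒¬ (p ∘ suc) (trans (sym (count-head-false p ¬p0)) eq) x

-- Enumerated types and partitions

record Enumeration (A : Set) : Set where
  field
    size          : ℕ
    decode        : Fin size → A
    encode        : A → Fin size
    encode-decode : ∀ i → encode (decode i) ≡ i
    decode-encode : ∀ x → decode (encode x) ≡ x
    index         : A → ℕ
    index-decode  : ∀ i → index (decode i) ≡ toℕ i

  elements : List A
  elements = tabulate decode

  length-elements : length elements ≡ size
  length-elements = length-tabulate decode

  encode-injective : ∀ {x y} → encode x ≡ encode y → x ≡ y
  encode-injective {x} {y} eq = trans (sym (decode-encode x)) (trans (cong decode eq) (decode-encode y))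

  index-encode : ∀ x → index x ≡ toℕ (encode x)
  index-encode x = trans (cong index (sym (decode-encode x))) (index-decode (encode x))

  index-injective : ∀ {x y} → index x ≡ index y → x ≡ y
  index-injective {x} {y} eq =
    encode-injective (toℕ-injective (trans (sym (index-encode x)) (trans eq (index-encode y))))

  _≟_ : (x y : A) → Dec (x ≡ y)
  x ≟ y with encode x ≟ᶠ encode y
  ... | yes eq = yes (encode-injective eq)
  ... | no neq = no (λ eq → neq (cong encode eq))

-- Classes are counted by their elements of least index, the way countCycles and
-- countClasses count them.
record Partition {A : Set} (E : Enumeration A) : Set₁ where
  open Enumeration E
  field
    _∼_              : A → A → Set
    ∼-isEquivalence  : IsEquivalence _∼_
    isLeast          : A → Bool
    isLeast-sound    : ∀ x → T (isLeast x) → ∀ y → x ∼ y → index x ≤ index y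
    isLeast-complete : ∀ x → (∀ y → x ∼ y → index x ≤ index y) → T (isLeast x)
    rep              : A → A
    ∼-rep            : ∀ x → x ∼ rep x
    rep-least        : ∀ x y → rep x ∼ y → index (rep x) ≤ index y

  open IsEquivalence ∼-isEquivalence public
    renaming (refl to ∼-refl; sym to ∼-sym; trans to ∼-trans)

  numClasses : ℕ
  numClasses = length (filterᵇ isLeast elements)

  least-unique : ∀ {x y} → x ∼ y → (∀ z → x ∼ z → index x ≤ index z) →
                 (∀ z → y ∼ z → index y ≤ index z) → x ≡ y
  least-unique x∼y x-least y-least = index-injective (≤-antisym (x-least _ x∼y) (y-least _ (∼-sym x∼y)))

  rep-cong : ∀ {x y} → x ∼ y → rep x ≡ rep y
  rep-cong {x} {y} x∼y =
    least-unique (∼-trans (∼-sym (∼-rep x)) (∼-trans x∼y (∼-rep y))) (rep-least x) (rep-least y)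

  rep-isLeast : ∀ x → T (isLeast (rep x))
  rep-isLeast x = isLeast-complete (rep x) (rep-least x)

  rep-of-least : ∀ x → T (isLeast x) → rep x ≡ x
  rep-of-least x least = least-unique (∼-sym (∼-rep x)) (rep-least x) (isLeast-sound x least)

  ∼-rep-index : ∀ {x y} → x ∼ y → index (rep x) ≤ index y
  ∼-rep-index {x} x∼y = rep-least x _ (∼-trans (∼-sym (∼-rep x)) x∼y)

  _∼?_ : ∀ x y → Dec (x ∼ y)
  x ∼? y with rep x ≟ rep y
  ... | yes eq = yes (∼-trans (∼-rep x) (subst (_∼ y) (sym eq) (∼-sym (∼-rep y))))
  ... | no neq = no (λ x∼y → neq (rep-cong x∼y))

open Partition using (numClasses)

Related : ∀ {A} {E : Enumeration A} → Partition E → A → A → Set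
Related = Partition._∼_

syntax Related P x y = x ∼[ P ] y

numClasses-count : ∀ {A} {E : Enumeration A} (P : Partition E) →
                   numClasses P ≡ count (λ i → Partition.isLeast P (Enumeration.decode E i))
numClasses-count {E = E} P = length-filterᵇ-tabulate (Enumeration.decode E) (Partition.isLeast P)

private
  rep-round-trip : ∀ {A B} {E : Enumeration A} {F : Enumeration B} (P : Partition E) (Q : Partition F)
                   (u : A → B) (v : B → A) →
                   (∀ {x y} → x ∼[ Q ] y → v x ∼[ P ] v y) → (∀ x → x ∼[ P ] v (u x)) →
                   ∀ x → T (Partition.isLeast P x) → Partition.rep P (v (Partition.rep Q (u x))) ≡ x
  rep-round-trip P Q u v v-resp vu x least = begin
    P.rep (v (Q.rep (u x)))  ≡⟨ P.rep-cong (v-resp (Q.∼-sym (Q.∼-rep _))) ⟩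
    P.rep (v (u x))          ≡⟨ P.rep-cong (P.∼-sym (vu x)) ⟩
    P.rep x                  ≡⟨ P.rep-of-least x least ⟩
    x                        ∎
    where
    open ≡-Reasoning
    module P = Partition P
    module Q = Partition Q

numClasses-≡ : ∀ {A B} {E : Enumeration A} {F : Enumeration B} (P : Partition E) (Q : Partition F)
               (u : A → B) (v : B → A) →
               (∀ {x y} → x ∼[ P ] y → u x ∼[ Q ] u y) →
               (∀ {x y} → x ∼[ Q ] y → v x ∼[ P ] v y) →
               (∀ x → x ∼[ P ] v (u x)) → (∀ y → y ∼[ Q ] u (v y)) →
               numClasses P ≡ numClasses Q
numClasses-≡ {E = E} {F} P Q u v u-resp v-resp vu uv =
  trans (numClasses-count P) (trans (bijection⇒count-≡ _ _ g h gP hQ hg gh) (sym (numClasses-count Q)))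
  where
  module E = Enumeration E
  module F = Enumeration F
  module P = Partition P
  module Q = Partition Q
  g : Fin E.size → Fin F.size
  g i = F.encode (Q.rep (u (E.decode i)))
  h : Fin F.size → Fin E.size
  h j = E.encode (P.rep (v (F.decode j)))
  gP : ∀ i → T (P.isLeast (E.decode i)) → T (Q.isLeast (F.decode (g i)))
  gP i _ rewrite F.decode-encode (Q.rep (u (E.decode i))) = Q.rep-isLeast _
  hQ : ∀ j → T (Q.isLeast (F.decode j)) → T (P.isLeast (E.decode (h j)))
  hQ j _ rewrite E.decode-encode (P.rep (v (F.decode j))) = P.rep-isLeast _
  hg : ∀ i → T (P.isLeast (E.decode i)) → h (g i) ≡ i
  hg i least rewrite F.decode-encode (Q.rep (u (E.decode i))) =
    trans (cong E.encode (rep-round-trip P Q u v v-resp vu _ least)) (E.encode-decode i)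
  gh : ∀ j → T (Q.isLeast (F.decode j)) → g (h j) ≡ j
  gh j least rewrite E.decode-encode (P.rep (v (F.decode j))) =
    trans (cong F.encode (rep-round-trip Q P v u u-resp uv _ least)) (F.encode-decode j)

module _ {A : Set} {E : Enumeration A} (P Q : Partition E)
         (Q⊆P : ∀ {x y} → x ∼[ Q ] y → x ∼[ P ] y) where
  open Enumeration E
  private
    module P = Partition P
    module Q = Partition Q

  P-least⇒Q-least : ∀ x → T (P.isLeast x) → T (Q.isLeast x)
  P-least⇒Q-least x least = Q.isLeast-complete x λ y x≈y → P.isLeast-sound x least y (Q⊆P x≈y)

  private
    split-ordered : (a b : A) → a ∼[ P ] b → ¬ a ∼[ Q ] b →
                    (∀ {x} → x ∼[ P ] a → x ∼[ Q ] a ⊎ x ∼[ Q ] b) →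
                    (∀ {x y} → ¬ x ∼[ P ] a → x ∼[ P ] y → x ∼[ Q ] y) →
                    index (Q.rep a) ≤ index (Q.rep b) → numClasses Q ≡ suc (numClasses P)
    split-ordered a b a∼b a≉b cover outside s≤l =
      trans (numClasses-count Q)
        (trans (count-insert _ _ (encode l) (λ i → P-least⇒Q-least (decode i)) l-Q-least l-not-P-least only-l)
               (cong suc (sym (numClasses-count P))))
      where
      s = Q.rep a
      l = Q.rep b
      s-P-least : ∀ y → s ∼[ P ] y → index s ≤ index y
      s-P-least y s∼y with cover (P.∼-trans (P.∼-sym s∼y) (Q⊆P (Q.∼-sym (Q.∼-rep a))))
      ... | inj₁ y≈a = Q.∼-rep-index (Q.∼-sym y≈a)
      ... | inj₂ y≈b = ≤-trans s≤l (Q.∼-rep-index (Q.∼-sym y≈b))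
      l≢s : l ≢ s
      l≢s l≡s = a≉b (Q.∼-trans (Q.∼-rep a) (subst (λ z → z ∼[ Q ] b) l≡s (Q.∼-sym (Q.∼-rep b))))
      l-Q-least : T (Q.isLeast (decode (encode l)))
      l-Q-least rewrite decode-encode l = Q.rep-isLeast b
      l-not-P-least : ¬ T (P.isLeast (decode (encode l)))
      l-not-P-least least rewrite decode-encode l =
        l≢s (index-injective (≤-antisym (P.isLeast-sound l least s l∼s) s≤l))
        where
        l∼s : l ∼[ P ] s
        l∼s = P.∼-trans (Q⊆P (Q.∼-sym (Q.∼-rep b))) (P.∼-trans (P.∼-sym a∼b) (Q⊆P (Q.∼-rep a)))
      only-l : ∀ i → T (Q.isLeast (decode i)) → ¬ T (P.isLeast (decode i)) → i ≡ encode l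
      only-l i Q-least ¬P-least = trans (sym (encode-decode i)) (cong encode x≡l)
        where
        x = decode i
        x≡rep : ∀ {y} → x ∼[ Q ] y → x ≡ Q.rep y
        x≡rep x≈y = trans (sym (Q.rep-of-least x Q-least)) (Q.rep-cong x≈y)
        x≡l : x ≡ l
        x≡l with x P.∼? a
        ... | no x≁a = ⊥-elim (¬P-least (P.isLeast-complete x λ y x∼y →
                                 Q.isLeast-sound x Q-least y (outside x≁a x∼y)))
        ... | yes x∼a with cover x∼a
        ...   | inj₂ x≈b = x≡rep x≈b
        ...   | inj₁ x≈a = ⊥-elim (¬P-least (subst (T ∘ P.isLeast) (sym (x≡rep x≈a))
                                                   (P.isLeast-complete s s-P-least)))

  numClasses-split : (a b : A) → a ∼[ P ] b → ¬ a ∼[ Q ] b →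
                     (∀ {x} → x ∼[ P ] a → x ∼[ Q ] a ⊎ x ∼[ Q ] b) →
                     (∀ {x y} → ¬ x ∼[ P ] a → x ∼[ P ] y → x ∼[ Q ] y) →
                     numClasses Q ≡ suc (numClasses P)
  numClasses-split a b a∼b a≉b cover outside with ≤-total (index (Q.rep a)) (index (Q.rep b))
  ... | inj₁ a≤b = split-ordered a b a∼b a≉b cover outside a≤b
  ... | inj₂ b≤a = split-ordered b a (P.∼-sym a∼b) (a≉b ∘ Q.∼-sym)
                     (swap ∘ cover ∘ λ x∼b → P.∼-trans x∼b (P.∼-sym a∼b))
                     (λ x≁b → outside (x≁b ∘ λ x∼a → P.∼-trans x∼a a∼b)) b≤a

-- Orbits of permutations

least-witness : {P : ℕ → Set} → Decidable P → ∀ n → P n → Σ[ k ∈ ℕ ] P k × (∀ j → j < k → ¬ P j)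
least-witness {P = P} P? = <-rec _ search
  where
  search : ∀ n → (∀ {m} → m < n → P m → Σ[ k ∈ ℕ ] P k × (∀ j → j < k → ¬ P j)) →
           P n → Σ[ k ∈ ℕ ] P k × (∀ j → j < k → ¬ P j)
  search n below Pn with anyUpTo? P? n
  ... | yes (m , m<n , Pm) = below m<n Pm
  ... | no none            = n , Pn , λ j j<n Pj → none (j , j<n , Pj)

allᵇ⇒All : (p : A → Bool) (xs : List A) → T (allᵇ p xs) → All (T ∘ p) xs
allᵇ⇒All p []       _ = []
allᵇ⇒All p (x ∷ xs) h = proj₁ (Equivalence.to T-∧ h) ∷ allᵇ⇒All p xs (proj₂ (Equivalence.to T-∧ h))

All⇒allᵇ : (p : A → Bool) (xs : List A) → All (T ∘ p) xs → T (allᵇ p xs)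
All⇒allᵇ p []       []         = _
All⇒allᵇ p (x ∷ xs) (px ∷ pxs) = Equivalence.from T-∧ (px , All⇒allᵇ p xs pxs)

allᵇ-upTo⁻ : (p : ℕ → Bool) (n : ℕ) → T (allᵇ p (upTo n)) → ∀ {k} → k < n → T (p k)
allᵇ-upTo⁻ p n h = applyUpTo⁻ id n (allᵇ⇒All p (upTo n) h)

allᵇ-upTo⁺ : (p : ℕ → Bool) (n : ℕ) → (∀ {k} → k < n → T (p k)) → T (allᵇ p (upTo n))
allᵇ-upTo⁺ p n h = All⇒allᵇ p (upTo n) (applyUpTo⁺₁ id n h)

iter-+ : (f : A → A) (m n : ℕ) (x : A) → iter f (m + n) x ≡ iter f m (iter f n x)
iter-+ f zero    n x = refl
iter-+ f (suc m) n x = cong f (iter-+ f m n x)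

iter-injective : (f : A → A) → (∀ {x y} → f x ≡ f y → x ≡ y) →
                 ∀ k {x y} → iter f k x ≡ iter f k y → x ≡ y
iter-injective f f-inj zero    eq = eq
iter-injective f f-inj (suc k) eq = iter-injective f f-inj k (f-inj eq)

iter-periodic : (f : A → A) {p : ℕ} {x : A} → iter f p x ≡ x → ∀ q → iter f (q * p) x ≡ x
iter-periodic f         fp≡x zero    = refl
iter-periodic f {p} {x} fp≡x (suc q) = begin
  iter f (p + q * p) x          ≡⟨ iter-+ f p (q * p) x ⟩
  iter f p (iter f (q * p) x)   ≡⟨ cong (iter f p) (iter-periodic f fp≡x q) ⟩
  iter f p x                    ≡⟨ fp≡x ⟩
  x                             ∎
  where open ≡-Reasoning

iter-mod : (f : A → A) {p : ℕ} {x : A} → iter f p x ≡ x → 0 < p →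
           ∀ k → Σ[ j ∈ ℕ ] j < p × iter f k x ≡ iter f j x
iter-mod f {p} {x} fp≡x 0<p k = k % p , m%n<n k p , (begin
  iter f k x                                 ≡⟨ cong (λ n → iter f n x) (m≡m%n+[m/n]*n k p) ⟩
  iter f (k % p + (k / p) * p) x             ≡⟨ iter-+ f (k % p) ((k / p) * p) x ⟩
  iter f (k % p) (iter f ((k / p) * p) x)    ≡⟨ cong (iter f (k % p)) (iter-periodic f fp≡x (k / p)) ⟩
  iter f (k % p) x                           ∎)
  where
  open ≡-Reasoning
  instance _ = >-nonZero 0<p

module Orbits {A : Set} (E : Enumeration A) (f : A → A) (f-injective : ∀ {x y} → f x ≡ f y → x ≡ y) where
  open Enumeration E

  infix 4 _↝_
  _↝_ : A → A → Set
  x ↝ y = Σ[ k ∈ ℕ ] iter f k x ≡ y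

  period : ∀ x → Σ[ p ∈ ℕ ] 0 < p × p ≤ size × iter f p x ≡ x
  period x with pigeonhole (n<1+n size) (λ (i : Fin (suc size)) → encode (iter f (toℕ i) x))
  ... | i , j , i<j , eq = toℕ j ∸ toℕ i , m<n⇒0<n∸m i<j ,
                           ≤-trans (m∸n≤m (toℕ j) (toℕ i)) (≤-pred (toℕ<n j)) , returns
    where
    returns : iter f (toℕ j ∸ toℕ i) x ≡ x
    returns = iter-injective f f-injective (toℕ i) (begin
      iter f (toℕ i) (iter f (toℕ j ∸ toℕ i) x)  ≡⟨ iter-+ f (toℕ i) _ x ⟨
      iter f (toℕ i + (toℕ j ∸ toℕ i)) x         ≡⟨ cong (λ n → iter f n x) (m+[n∸m]≡n (<⇒≤ i<j)) ⟩
      iter f (toℕ j) x                           ≡⟨ encode-injective eq ⟨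
      iter f (toℕ i) x                           ∎)
      where open ≡-Reasoning

  ↝-below-size : ∀ {x y} → x ↝ y → Σ[ j ∈ ℕ ] j < size × iter f j x ≡ y
  ↝-below-size {x} (k , refl) with period x
  ... | p , 0<p , p≤size , fp≡x with iter-mod f fp≡x 0<p k
  ...   | j , j<p , eq = j , <-≤-trans j<p p≤size , sym eq

  ↝-refl : ∀ {x} → x ↝ x
  ↝-refl = 0 , refl

  ↝-trans : ∀ {x y z} → x ↝ y → y ↝ z → x ↝ z
  ↝-trans {x} (k , refl) (l , refl) = l + k , iter-+ f l k x

  -- If suc p is a period of x, then p * k further steps take fᵏ x back to x.
  ↝-sym : ∀ {x y} → x ↝ y → y ↝ x
  ↝-sym {x} (k , refl) with period x
  ... | suc p , _ , _ , fp≡x = p * k , (begin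
    iter f (p * k) (iter f k x)   ≡⟨ iter-+ f (p * k) k x ⟨
    iter f (p * k + k) x          ≡⟨ cong (λ n → iter f n x) (trans (+-comm (p * k) k) (*-comm (suc p) k)) ⟩
    iter f (k * suc p) x          ≡⟨ iter-periodic f fp≡x k ⟩
    x                             ∎)
    where open ≡-Reasoning

  ↝-along : {B : Set} (h : B → A) (g : B → B) → (∀ y → h y ↝ h (g y)) → ∀ k y → h y ↝ h (iter g k y)
  ↝-along h g h-step zero    y = ↝-refl
  ↝-along h g h-step (suc k) y = ↝-trans (↝-along h g h-step k y) (h-step (iter g k y))

  ↝-isEquivalence : IsEquivalence _↝_
  ↝-isEquivalence = record { refl = ↝-refl ; sym = ↝-sym ; trans = ↝-trans }

  minimal-period : ∀ x → Σ[ p ∈ ℕ ] 0 < p × iter f p x ≡ x × (∀ j → 0 < j → j < p → iter f j x ≢ x)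
  minimal-period x with period x
  ... | p , 0<p , _ , fp≡x with least-witness returns? p (0<p , fp≡x)
    where
    returns? : Decidable (λ j → 0 < j × iter f j x ≡ x)
    returns? j = (0 <? j) ×-dec (iter f j x ≟ x)
  ...   | q , (0<q , fq≡x) , below = q , 0<q , fq≡x , λ j 0<j j<q fj≡x → below j j<q (0<j , fj≡x)

  orbit : A → List A
  orbit x = applyUpTo (λ k → iter f k x) size

  ∈-orbit : ∀ {x y} → y ∈ orbit x → x ↝ y
  ∈-orbit y∈ with ∈-applyUpTo⁻ _ y∈
  ... | k , _ , y≡ = k , sym y≡

  -- The test of countCycles, so that numClasses orbitPartition unfolds to
  -- countCycles elements index f.
  isLeastInOrbit : A → Bool
  isLeastInOrbit x = allᵇ (λ k → index x ≤ᵇ index (iter f k x)) (upTo (length elements))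

  isLeastInOrbit-sound : ∀ x → T (isLeastInOrbit x) → ∀ y → x ↝ y → index x ≤ index y
  isLeastInOrbit-sound x least y x↝y with ↝-below-size x↝y
  ... | j , j<size , refl =
    ≤ᵇ⇒≤ _ _ (allᵇ-upTo⁻ _ (length elements) least (subst (j <_) (sym length-elements) j<size))

  isLeastInOrbit-complete : ∀ x → (∀ y → x ↝ y → index x ≤ index y) → T (isLeastInOrbit x)
  isLeastInOrbit-complete x least = allᵇ-upTo⁺ _ (length elements) λ {k} _ → ≤⇒≤ᵇ (least _ (k , refl))

  orbitRep : A → A
  orbitRep x = argmin index x (orbit x)

  ↝-orbitRep : ∀ x → x ↝ orbitRep x
  ↝-orbitRep x with argmin-sel index x (orbit x)
  ... | inj₁ rep≡x = 0 , sym rep≡x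
  ... | inj₂ rep∈  = ∈-orbit rep∈

  orbitRep-least : ∀ x y → orbitRep x ↝ y → index (orbitRep x) ≤ index y
  orbitRep-least x y rep↝y with ↝-below-size (↝-trans (↝-orbitRep x) rep↝y)
  ... | j , j<size , refl = applyUpTo⁻ (λ k → iter f k x) size (f[argmin]≤f[xs] {f = index} x (orbit x)) j<size

  orbitPartition : Partition E
  orbitPartition = record
    { _∼_              = _↝_
    ; ∼-isEquivalence  = ↝-isEquivalence
    ; isLeast          = isLeastInOrbit
    ; isLeast-sound    = isLeastInOrbit-sound
    ; isLeast-complete = isLeastInOrbit-complete
    ; rep              = orbitRep
    ; ∼-rep            = ↝-orbitRep
    ; rep-least        = orbitRep-least
    }

module InvolutionClasses {A : Set} (E : Enumeration A) (τ π : A → A)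
                         (τ-involutive : ∀ x → τ (τ x) ≡ x) (π-involutive : ∀ x → π (π x) ≡ x) where
  open Enumeration E

  step : A → A
  step x = π (τ x)

  step-injective : ∀ {x y} → step x ≡ step y → x ≡ y
  step-injective {x} {y} eq = begin
    x              ≡⟨ τ-involutive x ⟨
    τ (τ x)        ≡⟨ cong τ (π-involutive (τ x)) ⟨
    τ (π (step x)) ≡⟨ cong (τ ∘ π) eq ⟩
    τ (π (step y)) ≡⟨ cong τ (π-involutive (τ y)) ⟩
    τ (τ y)        ≡⟨ τ-involutive y ⟩
    y              ∎
    where open ≡-Reasoning

  open Orbits E step step-injective

  τ-reverses : ∀ {x y} → x ↝ y → τ y ↝ τ x
  τ-reverses (zero  , refl) = ↝-refl
  τ-reverses {x} (suc k , refl) = ↝-trans (1 , back (iter step k x)) (τ-reverses (k , refl))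
    where
    back : ∀ w → step (τ (step w)) ≡ τ w
    back w = trans (cong π (τ-involutive (π (τ w)))) (π-involutive (τ w))

  -- The group generated by τ and π consists of the powers of step and their
  -- composites with τ, because τ ∘ step ∘ τ is the inverse of step.
  infix 4 _≈_
  _≈_ : A → A → Set
  x ≈ y = x ↝ y ⊎ x ↝ τ y

  ≈-refl : ∀ {x} → x ≈ x
  ≈-refl = inj₁ ↝-refl

  ≈-sym : ∀ {x y} → x ≈ y → y ≈ x
  ≈-sym         (inj₁ x↝y)  = inj₁ (↝-sym x↝y)
  ≈-sym {x} {y} (inj₂ x↝τy) = inj₂ (subst (_↝ τ x) (τ-involutive y) (τ-reverses x↝τy))

  ≈-trans : ∀ {x y z} → x ≈ y → y ≈ z → x ≈ z
  ≈-trans (inj₁ x↝y) (inj₁ y↝z)  = inj₁ (↝-trans x↝y y↝z)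
  ≈-trans (inj₁ x↝y) (inj₂ y↝τz) = inj₂ (↝-trans x↝y y↝τz)
  ≈-trans (inj₂ x↝τy) (inj₁ y↝z) = inj₂ (↝-trans x↝τy (↝-sym (τ-reverses y↝z)))
  ≈-trans {z = z} (inj₂ x↝τy) (inj₂ y↝τz) =
    inj₁ (↝-trans x↝τy (↝-sym (subst (_↝ τ _) (τ-involutive z) (τ-reverses y↝τz))))

  ≈-isEquivalence : IsEquivalence _≈_
  ≈-isEquivalence = record { refl = ≈-refl ; sym = ≈-sym ; trans = ≈-trans }

  ≈-below-size : ∀ {x y} → x ≈ y → Σ[ j ∈ ℕ ] j < size × (iter step j x ≡ y ⊎ τ (iter step j x) ≡ y)
  ≈-below-size (inj₁ x↝y) with ↝-below-size x↝y
  ... | j , j<size , eq = j , j<size , inj₁ eq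
  ≈-below-size {y = y} (inj₂ x↝τy) with ↝-below-size x↝τy
  ... | j , j<size , eq = j , j<size , inj₂ (trans (cong τ eq) (τ-involutive y))

  isLeastInClass : A → Bool
  isLeastInClass x = allᵇ (λ k → (index x ≤ᵇ index (iter step k x)) ∧ (index x ≤ᵇ index (τ (iter step k x))))
                          (upTo (length elements))

  isLeastInClass-sound : ∀ x → T (isLeastInClass x) → ∀ y → x ≈ y → index x ≤ index y
  isLeastInClass-sound x least y x≈y with ≈-below-size x≈y
  ... | j , j<size , y≡ = pick y≡ (Equivalence.to T-∧ bounds)
    where
    bounds = allᵇ-upTo⁻ _ (length elements) least (subst (j <_) (sym length-elements) j<size)
    pick : iter step j x ≡ y ⊎ τ (iter step j x) ≡ y →
           T (index x ≤ᵇ index (iter step j x)) × T (index x ≤ᵇ index (τ (iter step j x))) →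
           index x ≤ index y
    pick (inj₁ refl) (b , _) = ≤ᵇ⇒≤ _ _ b
    pick (inj₂ refl) (_ , b) = ≤ᵇ⇒≤ _ _ b

  isLeastInClass-complete : ∀ x → (∀ y → x ≈ y → index x ≤ index y) → T (isLeastInClass x)
  isLeastInClass-complete x least = allᵇ-upTo⁺ _ (length elements) λ {k} _ →
    Equivalence.from T-∧ ( ≤⇒≤ᵇ (least _ (inj₁ (k , refl)))
                         , ≤⇒≤ᵇ (least _ (inj₂ (k , sym (τ-involutive _)))))

  classCandidates : A → List A
  classCandidates x = orbit x ++ applyUpTo (λ k → τ (iter step k x)) size

  classRep : A → A
  classRep x = argmin index x (classCandidates x)

  ≈-classRep : ∀ x → x ≈ classRep x
  ≈-classRep x with argmin-sel index x (classCandidates x)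
  ... | inj₁ rep≡x = subst (x ≈_) (sym rep≡x) ≈-refl
  ... | inj₂ rep∈ with ∈-++⁻ (orbit x) rep∈
  ...   | inj₁ ∈orbit = inj₁ (∈-orbit ∈orbit)
  ...   | inj₂ ∈τorbit with ∈-applyUpTo⁻ _ ∈τorbit
  ...     | k , _ , rep≡ = inj₂ (k , trans (sym (τ-involutive _)) (cong τ (sym rep≡)))

  classRep-least : ∀ x y → classRep x ≈ y → index (classRep x) ≤ index y
  classRep-least x y rep≈y with ≈-below-size (≈-trans (≈-classRep x) rep≈y)
                              | ++⁻ (orbit x) (f[argmin]≤f[xs] {f = index} x (classCandidates x))
  ... | j , j<size , inj₁ refl | below , _ = applyUpTo⁻ (λ k → iter step k x) size below j<size
  ... | j , j<size , inj₂ refl | _ , below = applyUpTo⁻ (λ k → τ (iter step k x)) size below j<size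

  classPartition : Partition E
  classPartition = record
    { _∼_              = _≈_
    ; ∼-isEquivalence  = ≈-isEquivalence
    ; isLeast          = isLeastInClass
    ; isLeast-sound    = isLeastInClass-sound
    ; isLeast-complete = isLeastInClass-complete
    ; rep              = classRep
    ; ∼-rep            = ≈-classRep
    ; rep-least        = classRep-least
    }

-- Transpositions

module _ {A : Set} (E : Enumeration A) (a b : A) where
  open Enumeration E

  transpose : A → A
  transpose x with x ≟ a | x ≟ b
  ... | yes _ | _     = b
  ... | no _  | yes _ = a
  ... | no _  | no _  = x

  transpose-a : transpose a ≡ b
  transpose-a with a ≟ a
  ... | yes _   = refl
  ... | no a≢a  = ⊥-elim (a≢a refl)

  transpose-b : transpose b ≡ a
  transpose-b with b ≟ a | b ≟ b
  ... | yes b≡a | _      = b≡a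
  ... | no _    | yes _  = refl
  ... | no _    | no b≢b = ⊥-elim (b≢b refl)

  transpose-other : ∀ {x} → x ≢ a → x ≢ b → transpose x ≡ x
  transpose-other {x} x≢a x≢b with x ≟ a | x ≟ b
  ... | yes x≡a | _       = ⊥-elim (x≢a x≡a)
  ... | no _    | yes x≡b = ⊥-elim (x≢b x≡b)
  ... | no _    | no _    = refl

  transpose-involutive : ∀ x → transpose (transpose x) ≡ x
  transpose-involutive x with x ≟ a | x ≟ b
  ... | yes refl | _        = transpose-b
  ... | no _     | yes refl = transpose-a
  ... | no x≢a   | no x≢b   = transpose-other x≢a x≢b

module Transposition {A : Set} (E : Enumeration A) (f g : A → A) (f-injective : ∀ {x y} → f x ≡ f y → x ≡ y)
                     (a b : A) (a≢b : a ≢ b) (g≗f∘transpose : ∀ x → g x ≡ f (transpose E a b x)) where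
  open Enumeration E

  g-injective : ∀ {x y} → g x ≡ g y → x ≡ y
  g-injective {x} {y} eq = begin
    x                   ≡⟨ transpose-involutive E a b x ⟨
    transpose E a b (transpose E a b x) ≡⟨ cong (transpose E a b) (f-injective (trans (sym (g≗f∘transpose x)) (trans eq (g≗f∘transpose y)))) ⟩
    transpose E a b (transpose E a b y) ≡⟨ transpose-involutive E a b y ⟩
    y                   ∎
    where open ≡-Reasoning

  f≗g∘transpose : ∀ x → f x ≡ g (transpose E a b x)
  f≗g∘transpose x = trans (cong f (sym (transpose-involutive E a b x))) (sym (g≗f∘transpose (transpose E a b x)))

  module F = Orbits E f f-injective
  module G = Orbits E g g-injective
  open F using (_↝_)
  open G using () renaming (_↝_ to _↝′_)

  agree-until-a-or-b : ∀ x j → (∀ i → i < j → iter f i x ≢ a × iter f i x ≢ b) → iter g j x ≡ iter f j x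
  agree-until-a-or-b x zero    avoid = refl
  agree-until-a-or-b x (suc j) avoid = begin
    g (iter g j x)           ≡⟨ cong g (agree-until-a-or-b x j (λ i i<j → avoid i (m<n⇒m<1+n i<j))) ⟩
    g (iter f j x)           ≡⟨ g≗f∘transpose _ ⟩
    f (transpose E a b (iter f j x)) ≡⟨ cong f (transpose-other E a b (proj₁ (avoid j ≤-refl)) (proj₂ (avoid j ≤-refl))) ⟩
    f (iter f j x)           ∎
    where open ≡-Reasoning

  module _ (a↝b : a ↝ b) where

    transpose-↝ : ∀ z → z ↝ transpose E a b z
    transpose-↝ z = by-cases (z ≟ a) (z ≟ b)
      where
      by-cases : Dec (z ≡ a) → Dec (z ≡ b) → z ↝ transpose E a b z
      by-cases (yes refl) _          = subst (z ↝_) (sym (transpose-a E a b)) a↝b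
      by-cases (no _)     (yes refl) = subst (z ↝_) (sym (transpose-b E a b)) (F.↝-sym a↝b)
      by-cases (no z≢a)   (no z≢b)   = subst (z ↝_) (sym (transpose-other E a b z≢a z≢b)) F.↝-refl

    ↝′⇒↝ : ∀ {x y} → x ↝′ y → x ↝ y
    ↝′⇒↝ (zero  , refl) = F.↝-refl
    ↝′⇒↝ (suc k , refl) = F.↝-trans (↝′⇒↝ (k , refl)) (F.↝-trans (transpose-↝ _) (1 , sym (g≗f∘transpose _)))

    hits-a-or-b : ∀ {x} → x ↝ a → x ↝′ a ⊎ x ↝′ b
    hits-a-or-b {x} (k , fk≡a) with least-witness hits? k (inj₁ fk≡a)
      where
      hits? : Decidable (λ j → iter f j x ≡ a ⊎ iter f j x ≡ b)
      hits? j = (iter f j x ≟ a) ⊎-dec (iter f j x ≟ b)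
    ... | j , hit , before with agree-until-a-or-b x j (λ i i<j → before i i<j ∘ inj₁ , before i i<j ∘ inj₂) | hit
    ...   | gʲ≡fʲ | inj₁ fʲ≡a = inj₁ (j , trans gʲ≡fʲ fʲ≡a)
    ...   | gʲ≡fʲ | inj₂ fʲ≡b = inj₂ (j , trans gʲ≡fʲ fʲ≡b)

    away-from-a : ∀ {x y} → ¬ x ↝ a → x ↝ y → x ↝′ y
    away-from-a {x} x≁a (k , refl) =
      k , agree-until-a-or-b x k (λ i _ → (λ fⁱ≡a → x≁a (i , fⁱ≡a)) , (λ fⁱ≡b → x≁a (F.↝-trans (i , fⁱ≡b) (F.↝-sym a↝b))))

    -- With p the minimal period of a and b = fʳ a (r < p), the g-orbit of a stays
    -- in {fⁱ a | r < i ≤ p}, which does not contain b.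
    private
      module Cycle (p : ℕ) (fᵖa≡a : iter f p a ≡ a) (minimal : ∀ j → 0 < j → j < p → iter f j a ≢ a)
                   (r : ℕ) (r<p : r < p) (fʳa≡b : iter f r a ≡ b) where
        fⁱa≢b : ∀ {i} → r < i → i < p → iter f i a ≢ b
        fⁱa≢b {i} r<i i<p fⁱa≡b = minimal (i ∸ r) (m<n⇒0<n∸m r<i) (≤-<-trans (m∸n≤m i r) i<p)
          (iter-injective f f-injective r (begin
            iter f r (iter f (i ∸ r) a)  ≡⟨ iter-+ f r (i ∸ r) a ⟨
            iter f (r + (i ∸ r)) a       ≡⟨ cong (λ n → iter f n a) (m+[n∸m]≡n (<⇒≤ r<i)) ⟩
            iter f i a                   ≡⟨ trans fⁱa≡b (sym fʳa≡b) ⟩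
            iter f r a                   ∎))
          where open ≡-Reasoning

        Beyond : A → Set
        Beyond z = Σ[ i ∈ ℕ ] r < i × i ≤ p × iter f i a ≡ z

        b-not-beyond : ¬ Beyond b
        b-not-beyond (i , r<i , i≤p , fⁱa≡b) with m≤n⇒m<n∨m≡n i≤p
        ... | inj₁ i<p  = fⁱa≢b r<i i<p fⁱa≡b
        ... | inj₂ refl = a≢b (trans (sym fᵖa≡a) fⁱa≡b)

        beyond-step : ∀ {z} → Beyond z → Beyond (g z)
        beyond-step (i , r<i , i≤p , refl) with m≤n⇒m<n∨m≡n i≤p
        ... | inj₁ i<p = suc i , m<n⇒m<1+n r<i , i<p ,
          sym (trans (g≗f∘transpose _) (cong f (transpose-other E a b (minimal i (≤-<-trans z≤n r<i) i<p) (fⁱa≢b r<i i<p))))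
        ... | inj₂ refl = suc r , ≤-refl , r<p ,
          sym (trans (cong g fᵖa≡a) (trans (g≗f∘transpose a) (cong f (trans (transpose-a E a b) (sym fʳa≡b)))))

        beyond-orbit : ∀ j → Beyond (iter g j a)
        beyond-orbit zero    = p , r<p , ≤-refl , fᵖa≡a
        beyond-orbit (suc j) = beyond-step (beyond-orbit j)

    a≁′b : ¬ a ↝′ b
    a≁′b (j , gʲa≡b) with F.minimal-period a
    ... | p , 0<p , fᵖa≡a , minimal with iter-mod f fᵖa≡a 0<p (proj₁ a↝b)
    ...   | r , r<p , fᵏa≡fʳa = C.b-not-beyond (subst C.Beyond gʲa≡b (C.beyond-orbit j))
      where module C = Cycle p fᵖa≡a minimal r r<p (trans (sym fᵏa≡fʳa) (proj₂ a↝b))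

    split-cycle : numClasses G.orbitPartition ≡ suc (numClasses F.orbitPartition)
    split-cycle = numClasses-split F.orbitPartition G.orbitPartition ↝′⇒↝ a b a↝b a≁′b hits-a-or-b away-from-a

  join-cycles : ¬ a ↝ b → a ↝′ b
  join-cycles a≁b with F.minimal-period b
  ... | suc q , _ , fᵠb≡b , minimal = suc q , trans (follows q ≤-refl) fᵠb≡b
    where
    follows : ∀ i → i < suc q → iter g (suc i) a ≡ iter f (suc i) b
    follows zero    _   = trans (g≗f∘transpose a) (cong f (transpose-a E a b))
    follows (suc i) i<q = begin
      g (iter g (suc i) a)           ≡⟨ cong g (follows i (<-trans (n<1+n i) i<q)) ⟩
      g (iter f (suc i) b)           ≡⟨ g≗f∘transpose _ ⟩
      f (transpose E a b (iter f (suc i) b)) ≡⟨ cong f (transpose-other E a b (λ fb≡a → a≁b (F.↝-sym (suc i , fb≡a)))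
                                                            (minimal (suc i) z<s i<q)) ⟩
      f (iter f (suc i) b)           ∎
      where open ≡-Reasoning

module _ {A : Set} (E : Enumeration A) (f g : A → A) (f-injective : ∀ {x y} → f x ≡ f y → x ≡ y)
         (a b : A) (a≢b : a ≢ b) (g≗f∘transpose : ∀ x → g x ≡ f (transpose E a b x)) where
  private module T = Transposition E f g f-injective a b a≢b g≗f∘transpose

  numClasses-transposition : numClasses T.G.orbitPartition ≡ suc (numClasses T.F.orbitPartition) ⊎
                             numClasses T.F.orbitPartition ≡ suc (numClasses T.G.orbitPartition)
  numClasses-transposition with Partition._∼?_ T.F.orbitPartition a b
  ... | yes a↝b = inj₁ (T.split-cycle a↝b)
  ... | no a≁b  = inj₂ (Transposition.split-cycle E g f T.g-injective a b a≢b T.f≗g∘transpose (T.join-cycles a≁b))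

-- Enumerating darts and half-edges

finEnumeration : ∀ n → Enumeration (Fin n)
finEnumeration n = record
  { size = n ; decode = id ; encode = id ; encode-decode = λ _ → refl ; decode-encode = λ _ → refl
  ; index = toℕ ; index-decode = λ _ → refl }

-- A × B for a two-element type B, listed as (x₀ , b₀) , (x₀ , b₁) , (x₁ , b₀) , …
module _ {A B : Set} (E : Enumeration A) (bit : Fin 2 ↔ B) where
  open Enumeration E
  open Inverse bit

  pairWithBit : (idx : A × B → ℕ) → (∀ x y → idx (x , y) ≡ 2 * index x + toℕ (from y)) → Enumeration (A × B)
  pairWithBit idx idx-spec = record
    { size          = size * 2
    ; decode        = decode₂
    ; encode        = encode₂
    ; encode-decode = encode-decode₂
    ; decode-encode = decode-encode₂
    ; index         = idx
    ; index-decode  = index-decode₂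
    }
    where
    decode₂ : Fin (size * 2) → A × B
    decode₂ k = decode (proj₁ (remQuot {size} 2 k)) , to (proj₂ (remQuot {size} 2 k))
    encode₂ : A × B → Fin (size * 2)
    encode₂ (x , y) = combine (encode x) (from y)
    encode-decode₂ : ∀ k → encode₂ (decode₂ k) ≡ k
    encode-decode₂ k = trans (cong₂ combine (encode-decode _) (strictlyInverseʳ _)) (combine-remQuot {size} 2 k)
    decode-encode₂ : ∀ p → decode₂ (encode₂ p) ≡ p
    decode-encode₂ (x , y) =
      trans (cong (λ ij → decode (proj₁ ij) , to (proj₂ ij)) (remQuot-combine (encode x) (from y)))
            (cong₂ _,_ (decode-encode x) (strictlyInverseˡ y))
    index-decode₂ : ∀ k → idx (decode₂ k) ≡ toℕ k
    index-decode₂ k = begin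
      idx (decode₂ k)                                  ≡⟨ idx-spec _ _ ⟩
      2 * index (decode i) + toℕ (from (to j))         ≡⟨ cong₂ (λ m n → 2 * m + toℕ n) (index-decode i) (strictlyInverseʳ j) ⟩
      2 * toℕ i + toℕ j                                ≡⟨ toℕ-combine i j ⟨
      toℕ (combine i j)                                ≡⟨ cong toℕ (combine-remQuot {size} 2 k) ⟩
      toℕ k                                            ∎
      where
      open ≡-Reasoning
      i = proj₁ (remQuot {size} 2 k)
      j = proj₂ (remQuot {size} 2 k)

  concatMap-pairs-tabulate : ∀ {m} (h : Fin m → A) →
    concatMap (λ x → (x , to zero) ∷ (x , to (suc zero)) ∷ []) (tabulate h) ≡
    tabulate (λ k → h (proj₁ (remQuot {m} 2 k)) , to (proj₂ (remQuot {m} 2 k)))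
  concatMap-pairs-tabulate {ℕ.zero}  h = refl
  concatMap-pairs-tabulate {ℕ.suc m} h = cong (λ xs → (h zero , to zero) ∷ (h zero , to (suc zero)) ∷ xs)
                                              (concatMap-pairs-tabulate (h ∘ suc))

  elements-pairWithBit : (idx : A × B → ℕ) (idx-spec : ∀ x y → idx (x , y) ≡ 2 * index x + toℕ (from y)) →
    concatMap (λ x → (x , to zero) ∷ (x , to (suc zero)) ∷ []) elements ≡ Enumeration.elements (pairWithBit idx idx-spec)
  elements-pairWithBit idx idx-spec = concatMap-pairs-tabulate decode

2↔Side : Fin 2 ↔ Side
2↔Side = mk↔ₛ′ (λ { zero → R ; (suc zero) → L }) (λ { R → zero ; L → suc zero })
               (λ { R → refl ; L → refl }) (λ { zero → refl ; (suc zero) → refl })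

-- Indexes the half-edges of G_m at white darts: (e , side) stands for
-- (whiteDart e , side), with whiteDart defined from a colouring below.
EdgeSide : ℕ → Set
EdgeSide n = Fin n × Side

module _ (G : OrientableEmbeddedGraph) where
  dartIdx-bit : ∀ e b → dartIdx G (e , b) ≡ 2 * toℕ e + toℕ (Inverse.from 2↔Bool b)
  dartIdx-bit e false = refl
  dartIdx-bit e true  = refl

  dartEnumeration : Enumeration (Dart (nE G))
  dartEnumeration = pairWithBit (finEnumeration (nE G)) 2↔Bool (dartIdx G) dartIdx-bit

  halfIdx-bit : ∀ d side → halfIdx G (d , side) ≡ 2 * dartIdx G d + toℕ (Inverse.from 2↔Side side)
  halfIdx-bit d R = sym (+-identityʳ _)
  halfIdx-bit d L = refl

  halfEdgeEnumeration : Enumeration (HalfEdge (nE G))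
  halfEdgeEnumeration = pairWithBit dartEnumeration 2↔Side (halfIdx G) halfIdx-bit

  edgeSideEnumeration : Enumeration (EdgeSide (nE G))
  edgeSideEnumeration = pairWithBit (finEnumeration (nE G)) 2↔Side
    (λ y → 2 * toℕ (proj₁ y) + toℕ (Inverse.from 2↔Side (proj₂ y))) λ _ _ → refl

  darts-elements : darts G ≡ Enumeration.elements dartEnumeration
  darts-elements = elements-pairWithBit (finEnumeration (nE G)) 2↔Bool (dartIdx G) dartIdx-bit

  halfEdges-elements : halfEdges G ≡ Enumeration.elements halfEdgeEnumeration
  halfEdges-elements = trans (cong (concatMap λ d → (d , R) ∷ (d , L) ∷ []) darts-elements)
                             (elements-pairWithBit dartEnumeration 2↔Side (halfIdx G) halfIdx-bit)

-- Graph states of the medial graph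

α-involutive : ∀ {n} (d : Dart n) → α (α d) ≡ d
α-involutive (e , b) = cong (e ,_) (not-involutive b)

edge : ∀ {n} → HalfEdge n → Fin n
edge ((e , _) , _) = e

flipSide : Side → Side
flipSide R = L
flipSide L = R

flipSide-involutive : ∀ side → flipSide (flipSide side) ≡ side
flipSide-involutive R = refl
flipSide-involutive L = refl

pairAt : ∀ {n} → VState → HalfEdge n → HalfEdge n
pairAt white (d , side) = α d , flipSide side
pairAt black (d , side) = d , flipSide side
pairAt cross (d , side) = α d , side

pairAt-edge : ∀ {n} v (x : HalfEdge n) → edge (pairAt v x) ≡ edge x
pairAt-edge white _ = refl
pairAt-edge black _ = refl
pairAt-edge cross _ = refl

pairAt-involutive : ∀ {n} v (x : HalfEdge n) → pairAt v (pairAt v x) ≡ x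
pairAt-involutive white (d , R)    = cong (_, R) (α-involutive d)
pairAt-involutive white (d , L)    = cong (_, L) (α-involutive d)
pairAt-involutive black (d , R)    = refl
pairAt-involutive black (d , L)    = refl
pairAt-involutive cross (d , side) = cong (_, side) (α-involutive d)

module _ (G : OrientableEmbeddedGraph) where
  rot-rot⁻¹ : ∀ d → rot G (rot⁻¹ G d) ≡ d
  rot-rot⁻¹ = Inverse.strictlyInverseˡ (σ G)

  rot⁻¹-rot : ∀ d → rot⁻¹ G (rot G d) ≡ d
  rot⁻¹-rot = Inverse.strictlyInverseʳ (σ G)

  φ-injective : ∀ {d d′} → φ G d ≡ φ G d′ → d ≡ d′
  φ-injective {d} {d′} eq = begin
    d                          ≡⟨ α-involutive d ⟨
    α (α d)                    ≡⟨ cong α (rot⁻¹-rot (α d)) ⟨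
    α (rot⁻¹ G (rot G (α d)))  ≡⟨ cong (α ∘ rot⁻¹ G) eq ⟩
    α (rot⁻¹ G (rot G (α d′))) ≡⟨ cong α (rot⁻¹-rot (α d′)) ⟩
    α (α d′)                   ≡⟨ α-involutive d′ ⟩
    d′                         ∎
    where open ≡-Reasoning

  faceOrbits : Partition (dartEnumeration G)
  faceOrbits = Orbits.orbitPartition (dartEnumeration G) (φ G) φ-injective

  medialEdge-involutive : ∀ x → medialEdge G (medialEdge G x) ≡ x
  medialEdge-involutive (c , R) = cong (_, R) (rot⁻¹-rot c)
  medialEdge-involutive (c , L) = cong (_, L) (rot-rot⁻¹ c)

  statePair-pairAt : ∀ s x → statePair G s x ≡ pairAt (s (edge x)) x
  statePair-pairAt s ((e , b) , side) with s e
  statePair-pairAt s ((e , b) , R) | white = refl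
  statePair-pairAt s ((e , b) , L) | white = refl
  statePair-pairAt s ((e , b) , R) | black = refl
  statePair-pairAt s ((e , b) , L) | black = refl
  statePair-pairAt s ((e , b) , side) | cross = refl

  statePair-involutive : ∀ s x → statePair G s (statePair G s x) ≡ x
  statePair-involutive s x = begin
    statePair G s (statePair G s x)           ≡⟨ statePair-pairAt s _ ⟩
    pairAt (s (edge (statePair G s x))) (statePair G s x)
                                              ≡⟨ cong (λ y → pairAt (s (edge y)) y) (statePair-pairAt s x) ⟩
    pairAt (s (edge (pairAt v x))) (pairAt v x) ≡⟨ cong (λ e → pairAt (s e) (pairAt v x)) (pairAt-edge v x) ⟩
    pairAt v (pairAt v x)                     ≡⟨ pairAt-involutive v x ⟩
    x                                         ∎
    where
    open ≡-Reasoning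
    v = s (edge x)

  module StateCurves (s : GState G) =
    InvolutionClasses (halfEdgeEnumeration G) (medialEdge G) (statePair G s)
                      medialEdge-involutive (statePair-involutive s)

  numFaces-faceOrbits : numFaces G ≡ numClasses faceOrbits + nIso G
  numFaces-faceOrbits = cong (λ ds → countCycles ds (dartIdx G) (φ G) + nIso G) (darts-elements G)

  numCurves-stateClasses : ∀ s → numCurves G s ≡ numClasses (StateCurves.classPartition s) + nIso G
  numCurves-stateClasses s =
    cong (λ hs → countClasses hs (halfIdx G) (medialEdge G) (statePair G s) + nIso G) (halfEdges-elements G)


module _ (G : OrientableEmbeddedGraph) where
  whitenAt : Fin (nE G) → GState G → GState G
  whitenAt e₀ s e with e ≟ᶠ e₀
  ... | yes _ = white
  ... | no _  = s e

  whitenAt-here : ∀ e₀ s → whitenAt e₀ s e₀ ≡ white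
  whitenAt-here e₀ s with e₀ ≟ᶠ e₀
  ... | yes _    = refl
  ... | no e₀≢e₀ = ⊥-elim (e₀≢e₀ refl)

  whitenAt-elsewhere : ∀ {e₀ e} s → e ≢ e₀ → whitenAt e₀ s e ≡ s e
  whitenAt-elsewhere {e₀} {e} s e≢e₀ with e ≟ᶠ e₀
  ... | yes e≡e₀ = ⊥-elim (e≢e₀ e≡e₀)
  ... | no _     = refl

  whitenAt-penrose : ∀ e₀ s → Penrose G s → Penrose G (whitenAt e₀ s)
  whitenAt-penrose e₀ s penrose e with e ≟ᶠ e₀
  ... | yes _ = λ ()
  ... | no _  = penrose e

  numCross-count : ∀ s → numCross G s ≡ count (isCross ∘ s)
  numCross-count s = length-filterᵇ-tabulate id (isCross ∘ s)

  numCross-whitenAt : ∀ e₀ s → s e₀ ≡ cross → numCross G s ≡ suc (numCross G (whitenAt e₀ s))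
  numCross-whitenAt e₀ s crossing = begin
    numCross G s                           ≡⟨ numCross-count s ⟩
    count (isCross ∘ s)                    ≡⟨ count-insert _ _ e₀ fewer (subst (T ∘ isCross) (sym crossing) _) not-here only-here ⟩
    suc (count (isCross ∘ whitenAt e₀ s))  ≡⟨ cong suc (numCross-count (whitenAt e₀ s)) ⟨
    suc (numCross G (whitenAt e₀ s))       ∎
    where
    open ≡-Reasoning
    not-here : ¬ T (isCross (whitenAt e₀ s e₀))
    not-here rewrite whitenAt-here e₀ s = λ ()
    fewer : ∀ e → T (isCross (whitenAt e₀ s e)) → T (isCross (s e))
    fewer e c with e ≟ᶠ e₀
    ... | no _ = c
    only-here : ∀ e → T (isCross (s e)) → ¬ T (isCross (whitenAt e₀ s e)) → e ≡ e₀
    only-here e c ¬c with e ≟ᶠ e₀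
    ... | yes e≡e₀ = e≡e₀
    ... | no _     = ⊥-elim (¬c c)

parity-switch : ∀ {c c′ k k′} → c ≡ suc c′ → k ≡ suc k′ ⊎ k′ ≡ suc k → (c + k) % 2 ≡ (c′ + k′) % 2
parity-switch {c′ = c′} {k′ = k′} refl (inj₁ refl) = begin
  (suc c′ + suc k′) % 2      ≡⟨ cong (λ m → suc m % 2) (+-suc c′ k′) ⟩
  (2 + (c′ + k′)) % 2        ≡⟨ cong (_% 2) (+-comm 2 (c′ + k′)) ⟩
  (c′ + k′ + 2) % 2          ≡⟨ [m+n]%n≡m%n (c′ + k′) 2 ⟩
  (c′ + k′) % 2              ∎
  where open ≡-Reasoning
parity-switch {c′ = c′} {k = k} refl (inj₂ refl) = cong (_% 2) (sym (+-suc c′ k))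

white-state : ∀ v → v ≢ black → ¬ T (isCross v) → v ≡ white
white-state white _ _ = refl
white-state black v≢black _ = ⊥-elim (v≢black refl)
white-state cross _ ¬cross = ⊥-elim (¬cross _)

cross-state : ∀ v → T (isCross v) → v ≡ cross
cross-state cross _ = refl


-- Checkerboard colourings and Penrose states

module Checkerboard (G : OrientableEmbeddedGraph) (col : Dart (nE G) → Bool)
                    (col-φ : ∀ d → col (φ G d) ≡ col d) (col-α : ∀ d → col (α d) ≢ col d) where
  col-α-not : ∀ d → col (α d) ≡ not (col d)
  col-α-not d = ¬-not (col-α d)

  col-rot : ∀ d → col (rot G d) ≡ not (col d)
  col-rot d = begin
    col (rot G d)          ≡⟨ cong (col ∘ rot G) (α-involutive d) ⟨
    col (φ G (α d))        ≡⟨ col-φ (α d) ⟩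
    col (α d)              ≡⟨ col-α-not d ⟩
    not (col d)            ∎
    where open ≡-Reasoning

  col-rot⁻¹ : ∀ d → col (rot⁻¹ G d) ≡ not (col d)
  col-rot⁻¹ d = begin
    col (rot⁻¹ G d)                  ≡⟨ not-involutive _ ⟨
    not (not (col (rot⁻¹ G d)))      ≡⟨ cong not (col-rot (rot⁻¹ G d)) ⟨
    not (col (rot G (rot⁻¹ G d)))    ≡⟨ cong (not ∘ col) (rot-rot⁻¹ G d) ⟩
    not (col d)                      ∎
    where open ≡-Reasoning

  same-edge-same-colour : ∀ {d d′ : Dart (nE G)} → proj₁ d ≡ proj₁ d′ → col d ≡ col d′ → d ≡ d′
  same-edge-same-colour {e , false} {.e , false} refl _ = refl
  same-edge-same-colour {e , true}  {.e , true}  refl _ = refl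
  same-edge-same-colour {e , false} {.e , true}  refl c = ⊥-elim (col-α (e , false) (sym c))
  same-edge-same-colour {e , true}  {.e , false} refl c = ⊥-elim (col-α (e , true) (sym c))

  colour : HalfEdge (nE G) → Bool
  colour (d , _) = col d

  colour-medialEdge : ∀ x → colour (medialEdge G x) ≡ not (colour x)
  colour-medialEdge (c , R) = col-rot c
  colour-medialEdge (c , L) = col-rot⁻¹ c

  colour-statePair : ∀ s → Penrose G s → ∀ x → colour (statePair G s x) ≡ not (colour x)
  colour-statePair s penrose x rewrite statePair-pairAt G s x with s (edge x) in eq
  ... | white = col-α-not (proj₁ x)
  ... | black = ⊥-elim (penrose (edge x) eq)
  ... | cross = col-α-not (proj₁ x)

  whiteDart : Fin (nE G) → Dart (nE G)
  whiteDart e = e , col (e , false)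

  col-whiteDart : ∀ e → col (whiteDart e) ≡ false
  col-whiteDart e with col (e , false) in eq
  ... | false = eq
  ... | true  = trans (col-α-not (e , false)) (cong not eq)

  ι : EdgeSide (nE G) → HalfEdge (nE G)
  ι (e , side) = whiteDart e , side

  prj : HalfEdge (nE G) → EdgeSide (nE G)
  prj x = edge x , proj₂ x

  colour-ι : ∀ y → colour (ι y) ≡ false
  colour-ι (e , _) = col-whiteDart e

  ι-prj : ∀ x → colour x ≡ false → ι (prj x) ≡ x
  ι-prj ((e , b) , side) c≡false = cong (_, side) (same-edge-same-colour refl (trans (col-whiteDart e) (sym c≡false)))

  toWhite : HalfEdge (nE G) → HalfEdge (nE G)
  toWhite x = if colour x then medialEdge G x else x

  colour-toWhite : ∀ x → colour (toWhite x) ≡ false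
  colour-toWhite x with colour x in c
  ... | true  = trans (colour-medialEdge x) (cong not c)
  ... | false = c

  toWhite-white : ∀ x → colour x ≡ false → toWhite x ≡ x
  toWhite-white x c rewrite c = refl

  -- Along the curves of a Penrose state, half-edges keep their colour, so the
  -- curves are traced by the following map on the white half-edges alone.
  whiteStep : GState G → EdgeSide (nE G) → EdgeSide (nE G)
  whiteStep s y = prj (StateCurves.step G s (ι y))

  module _ (s : GState G) (penrose : Penrose G s) where
    open StateCurves G s using (step; _≈_; ≈-sym; ≈-trans; classPartition)

    colour-step : ∀ x → colour (step x) ≡ colour x
    colour-step x = begin
      colour (statePair G s (medialEdge G x))  ≡⟨ colour-statePair s penrose (medialEdge G x) ⟩
      not (colour (medialEdge G x))            ≡⟨ cong not (colour-medialEdge x) ⟩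
      not (not (colour x))                     ≡⟨ not-involutive _ ⟩
      colour x                                 ∎
      where open ≡-Reasoning

    colour-iter : ∀ k x → colour (iter step k x) ≡ colour x
    colour-iter zero    x = refl
    colour-iter (suc k) x = trans (colour-step (iter step k x)) (colour-iter k x)

    ι-whiteStep : ∀ y → ι (whiteStep s y) ≡ step (ι y)
    ι-whiteStep y = ι-prj _ (trans (colour-step (ι y)) (colour-ι y))

    whiteStep-injective : ∀ {y y′} → whiteStep s y ≡ whiteStep s y′ → y ≡ y′
    whiteStep-injective {y} {y′} eq = cong prj (StateCurves.step-injective G s
      (trans (sym (ι-whiteStep y)) (trans (cong ι eq) (ι-whiteStep y′))))

    ι-iter : ∀ k y → ι (iter (whiteStep s) k y) ≡ iter step k (ι y)
    ι-iter zero    y = refl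
    ι-iter (suc k) y = trans (ι-whiteStep (iter (whiteStep s) k y)) (cong step (ι-iter k y))

    whiteOrbits : Partition (edgeSideEnumeration G)
    whiteOrbits = Orbits.orbitPartition (edgeSideEnumeration G) (whiteStep s) whiteStep-injective

    ≈-toWhite : ∀ x → x ≈ toWhite x
    ≈-toWhite x with colour x
    ... | true  = inj₂ (0 , sym (medialEdge-involutive G x))
    ... | false = inj₁ (0 , refl)

    ≈-white⇒↝ : ∀ {x y} → colour x ≡ false → colour y ≡ false → x ≈ y → Σ[ k ∈ ℕ ] iter step k x ≡ y
    ≈-white⇒↝ _ _ (inj₁ x↝y) = x↝y
    ≈-white⇒↝ {x} {y} x-white y-white (inj₂ (k , eq)) = case false≡true of λ ()
      where
      open ≡-Reasoning
      false≡true : false ≡ true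
      false≡true = begin
        false                     ≡⟨ x-white ⟨
        colour x                  ≡⟨ colour-iter k x ⟨
        colour (iter step k x)    ≡⟨ cong colour eq ⟩
        colour (medialEdge G y)   ≡⟨ colour-medialEdge y ⟩
        not (colour y)            ≡⟨ cong not y-white ⟩
        true                      ∎

    numCurves-whiteOrbits : numClasses classPartition ≡ numClasses whiteOrbits
    numCurves-whiteOrbits = numClasses-≡ classPartition whiteOrbits u ι u-resp ι-resp ι-u u-ι
      where
      u : HalfEdge (nE G) → EdgeSide (nE G)
      u = prj ∘ toWhite
      u-resp : ∀ {x y} → x ≈ y → Σ[ k ∈ ℕ ] iter (whiteStep s) k (u x) ≡ u y
      u-resp {x} {y} x≈y with ≈-white⇒↝ (colour-toWhite x) (colour-toWhite y)
                                (≈-trans (≈-sym (≈-toWhite x)) (≈-trans x≈y (≈-toWhite y)))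
      ... | k , eq = k , (begin
        iter (whiteStep s) k (u x)           ≡⟨ cong prj (ι-iter k (u x)) ⟩
        prj (iter step k (ι (u x)))          ≡⟨ cong (prj ∘ iter step k) (ι-prj _ (colour-toWhite x)) ⟩
        prj (iter step k (toWhite x))        ≡⟨ cong prj eq ⟩
        u y                                  ∎)
        where open ≡-Reasoning
      ι-resp : ∀ {y y′} → Σ[ k ∈ ℕ ] iter (whiteStep s) k y ≡ y′ → ι y ≈ ι y′
      ι-resp {y} (k , refl) = inj₁ (k , sym (ι-iter k y))
      ι-u : ∀ x → x ≈ ι (u x)
      ι-u x = subst (x ≈_) (sym (ι-prj _ (colour-toWhite x))) (≈-toWhite x)
      u-ι : ∀ y → Σ[ k ∈ ℕ ] iter (whiteStep s) k y ≡ u (ι y)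
      u-ι y = 0 , cong prj (sym (toWhite-white (ι y) (colour-ι y)))

  whiteDart-of-black : ∀ d → col d ≡ true → whiteDart (proj₁ d) ≡ α d
  whiteDart-of-black d c = same-edge-same-colour refl
    (trans (col-whiteDart _) (sym (trans (col-α-not d) (cong not c))))

  -- White half-edges on the R side stand for the black dart of their edge, those
  -- on the L side for the white dart.
  toDart : EdgeSide (nE G) → Dart (nE G)
  toDart (e , R) = α (whiteDart e)
  toDart (e , L) = whiteDart e

  fromDart : Dart (nE G) → EdgeSide (nE G)
  fromDart d = proj₁ d , (if col d then R else L)

  fromDart-toDart : ∀ y → fromDart (toDart y) ≡ y
  fromDart-toDart (e , R) rewrite col-α-not (whiteDart e) | col-whiteDart e = refl
  fromDart-toDart (e , L) rewrite col-whiteDart e = refl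

  toDart-fromDart : ∀ d → toDart (fromDart d) ≡ d
  toDart-fromDart d with col d in c
  ... | true  = trans (cong α (whiteDart-of-black d c)) (α-involutive d)
  ... | false = same-edge-same-colour refl (trans (col-whiteDart _) (sym c))

  fromDart-φ : ∀ d → fromDart (φ G d) ≡ (proj₁ (φ G d) , proj₂ (fromDart d))
  fromDart-φ d rewrite col-φ d = refl

  module _ (s : GState G) (all-white : ∀ e → s e ≡ white) where
    all-white-penrose : Penrose G s
    all-white-penrose e s≡black = case trans (sym (all-white e)) s≡black of λ ()

    open Orbits (dartEnumeration G) (φ G) (φ-injective G) using () renaming (_↝_ to _↝φ_; ↝-sym to ↝φ-sym; ↝-along to ↝φ-along)
    open Orbits (edgeSideEnumeration G) (whiteStep s) (whiteStep-injective s all-white-penrose) using () renaming (_↝_ to _↝w_; ↝-sym to ↝w-sym; ↝-along to ↝w-along)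

    whiteStep-at : ∀ e side → whiteStep s (e , side) ≡ prj (pairAt white (medialEdge G (whiteDart e , side)))
    whiteStep-at e side = cong prj (trans (statePair-pairAt G s _) (cong (λ v → pairAt v _) (all-white _)))

    toDart-step-R : ∀ e → toDart (whiteStep s (e , R)) ≡ φ G (toDart (e , R))
    toDart-step-R e = begin
      toDart (whiteStep s (e , R))            ≡⟨ cong toDart (whiteStep-at e R) ⟩
      α (whiteDart (proj₁ (rot G w)))         ≡⟨ cong α (whiteDart-of-black (rot G w) (trans (col-rot w) (cong not (col-whiteDart e)))) ⟩
      α (α (rot G w))                         ≡⟨ α-involutive _ ⟩
      rot G w                                 ≡⟨ cong (rot G) (α-involutive w) ⟨
      φ G (α w)                               ∎
      where
      open ≡-Reasoning
      w = whiteDart e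

    φ-toDart-step-L : ∀ e → φ G (toDart (whiteStep s (e , L))) ≡ toDart (e , L)
    φ-toDart-step-L e = begin
      φ G (toDart (whiteStep s (e , L)))      ≡⟨ cong (φ G ∘ toDart) (whiteStep-at e L) ⟩
      φ G (whiteDart (proj₁ (rot⁻¹ G w)))     ≡⟨ cong (φ G) (whiteDart-of-black (rot⁻¹ G w) (trans (col-rot⁻¹ w) (cong not (col-whiteDart e)))) ⟩
      rot G (α (α (rot⁻¹ G w)))               ≡⟨ cong (rot G) (α-involutive _) ⟩
      rot G (rot⁻¹ G w)                       ≡⟨ rot-rot⁻¹ G w ⟩
      w                                       ∎
      where
      open ≡-Reasoning
      w = whiteDart e

    toDart-step : ∀ y → toDart y ↝φ toDart (whiteStep s y)
    toDart-step (e , R) = 1 , sym (toDart-step-R e)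
    toDart-step (e , L) = ↝φ-sym (1 , φ-toDart-step-L e)

    fromDart-step : ∀ d → fromDart d ↝w fromDart (φ G d)
    fromDart-step d = by-side (fromDart d) refl
      where
      open ≡-Reasoning
      d≡toDart : ∀ {y} → fromDart d ≡ y → d ≡ toDart y
      d≡toDart eq = trans (sym (toDart-fromDart d)) (cong toDart eq)
      by-side : ∀ y → fromDart d ≡ y → fromDart d ↝w fromDart (φ G d)
      by-side (e , R) eq = 1 , (begin
        whiteStep s (fromDart d)                  ≡⟨ cong (whiteStep s) eq ⟩
        whiteStep s (e , R)                       ≡⟨ fromDart-toDart _ ⟨
        fromDart (toDart (whiteStep s (e , R)))   ≡⟨ cong fromDart (toDart-step-R e) ⟩
        fromDart (φ G (toDart (e , R)))           ≡⟨ cong (fromDart ∘ φ G) (d≡toDart eq) ⟨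
        fromDart (φ G d)                          ∎)
      by-side (e , L) eq = ↝w-sym (1 , (begin
        whiteStep s (fromDart (φ G d))                  ≡⟨ fromDart-toDart _ ⟨
        fromDart (toDart (whiteStep s (fromDart (φ G d)))) ≡⟨ cong fromDart (φ-injective G (begin
            φ G (toDart (whiteStep s (fromDart (φ G d))))  ≡⟨ cong (λ y → φ G (toDart (whiteStep s y))) φd-on-L ⟩
            φ G (toDart (whiteStep s (e′ , L)))            ≡⟨ φ-toDart-step-L e′ ⟩
            toDart (e′ , L)                               ≡⟨ cong toDart φd-on-L ⟨
            toDart (fromDart (φ G d))                     ≡⟨ toDart-fromDart (φ G d) ⟩
            φ G d                                         ∎)) ⟩
        fromDart d                                      ∎))
        where
        e′ = proj₁ (φ G d)
        φd-on-L : fromDart (φ G d) ≡ (e′ , L)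
        φd-on-L = trans (fromDart-φ d) (cong (e′ ,_) (cong proj₂ eq))

    numFaces-whiteOrbits : numClasses (faceOrbits G) ≡ numClasses (whiteOrbits s all-white-penrose)
    numFaces-whiteOrbits = numClasses-≡ (faceOrbits G) (whiteOrbits s all-white-penrose) fromDart toDart
      (λ { {d} (k , refl) → ↝w-along fromDart (φ G) fromDart-step k d })
      (λ { {y} (k , refl) → ↝φ-along toDart (whiteStep s) toDart-step k y })
      (λ d → 0 , sym (toDart-fromDart d))
      (λ y → 0 , sym (fromDart-toDart y))

  whiteStep-through : ∀ s y {x} → medialEdge G (ι y) ≡ x → whiteStep s y ≡ prj (pairAt (s (edge x)) x)
  whiteStep-through s y refl = cong prj (statePair-pairAt G s _)

  -- Switching the crossing at e₀ to a white split exchanges the successors of the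
  -- two white half-edges a₀ , b₀ whose medial edges end at the black dart d₁ of e₀.
  module _ (s : GState G) (penrose : Penrose G s) (e₀ : Fin (nE G)) (crossing : s e₀ ≡ cross) where
    private
      s′ = whitenAt G e₀ s
      penrose′ = whitenAt-penrose G e₀ s penrose

    d₁ : Dart (nE G)
    d₁ = α (whiteDart e₀)

    col-d₁ : col d₁ ≡ true
    col-d₁ = trans (col-α-not _) (cong not (col-whiteDart e₀))

    a₀ b₀ : EdgeSide (nE G)
    a₀ = prj (rot G d₁ , L)
    b₀ = prj (rot⁻¹ G d₁ , R)

    a₀≢b₀ : a₀ ≢ b₀
    a₀≢b₀ ()

    medialEdge-ι-a₀ : medialEdge G (ι a₀) ≡ (d₁ , R)
    medialEdge-ι-a₀ = trans (cong (medialEdge G) (ι-prj (rot G d₁ , L) (trans (col-rot d₁) (cong not col-d₁))))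
                            (cong (_, R) (rot⁻¹-rot G d₁))

    medialEdge-ι-b₀ : medialEdge G (ι b₀) ≡ (d₁ , L)
    medialEdge-ι-b₀ = trans (cong (medialEdge G) (ι-prj (rot⁻¹ G d₁ , R) (trans (col-rot⁻¹ d₁) (cong not col-d₁))))
                            (cong (_, L) (rot-rot⁻¹ G d₁))

    crossing-vs-white : ∀ y y′ side → medialEdge G (ι y) ≡ (d₁ , side) →
                        medialEdge G (ι y′) ≡ (d₁ , flipSide side) → whiteStep s y ≡ whiteStep s′ y′
    crossing-vs-white y y′ side y↦d₁ y′↦d₁ = begin
      whiteStep s y                              ≡⟨ whiteStep-through s y y↦d₁ ⟩
      prj (pairAt (s e₀) (d₁ , side))            ≡⟨ cong (λ v → prj (pairAt v (d₁ , side))) crossing ⟩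
      (e₀ , side)                                ≡⟨ cong (e₀ ,_) (flipSide-involutive side) ⟨
      prj (pairAt white (d₁ , flipSide side))    ≡⟨ cong (λ v → prj (pairAt v (d₁ , flipSide side))) (whitenAt-here G e₀ s) ⟨
      prj (pairAt (s′ e₀) (d₁ , flipSide side))  ≡⟨ whiteStep-through s′ y′ y′↦d₁ ⟨
      whiteStep s′ y′                            ∎
      where open ≡-Reasoning

    whiteStep-elsewhere : ∀ y → y ≢ a₀ → y ≢ b₀ → whiteStep s y ≡ whiteStep s′ y
    whiteStep-elsewhere y y≢a₀ y≢b₀ = by-edge (edge z ≟ᶠ e₀)
      where
      z = medialEdge G (ι y)
      at-d₁ : ∀ side → proj₁ z ≡ d₁ → proj₂ z ≡ side → ⊥
      at-d₁ side dart-z side-z with trans (sym (medialEdge-involutive G (ι y))) (cong (medialEdge G) (cong₂ _,_ dart-z side-z))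
      at-d₁ R _ _ | ι-y≡ = y≢a₀ (cong prj ι-y≡)
      at-d₁ L _ _ | ι-y≡ = y≢b₀ (cong prj ι-y≡)
      by-edge : Dec (edge z ≡ e₀) → whiteStep s y ≡ whiteStep s′ y
      by-edge (yes e≡e₀) = ⊥-elim (at-d₁ (proj₂ z) (same-edge-same-colour e≡e₀ colour-z) refl)
        where
        colour-z : col (proj₁ z) ≡ col d₁
        colour-z = trans (trans (colour-medialEdge (ι y)) (cong not (colour-ι y))) (sym col-d₁)
      by-edge (no e≢e₀) = begin
        whiteStep s y                 ≡⟨ whiteStep-through s y refl ⟩
        prj (pairAt (s (edge z)) z)   ≡⟨ cong (λ v → prj (pairAt v z)) (whitenAt-elsewhere G s e≢e₀) ⟨
        prj (pairAt (s′ (edge z)) z)  ≡⟨ whiteStep-through s′ y refl ⟨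
        whiteStep s′ y                ∎
        where open ≡-Reasoning

    whiteStep-transpose : ∀ y → whiteStep s y ≡ whiteStep s′ (transpose (edgeSideEnumeration G) a₀ b₀ y)
    whiteStep-transpose y = by-cases (y ≟ a₀) (y ≟ b₀)
      where
      open Enumeration (edgeSideEnumeration G) using (_≟_)
      by-cases : Dec (y ≡ a₀) → Dec (y ≡ b₀) → whiteStep s y ≡ whiteStep s′ (transpose (edgeSideEnumeration G) a₀ b₀ y)
      by-cases (yes refl) _ = trans (crossing-vs-white a₀ b₀ R medialEdge-ι-a₀ medialEdge-ι-b₀) (cong (whiteStep s′) (sym (transpose-a (edgeSideEnumeration G) a₀ b₀)))
      by-cases (no _) (yes refl) = trans (crossing-vs-white b₀ a₀ L medialEdge-ι-b₀ medialEdge-ι-a₀) (cong (whiteStep s′) (sym (transpose-b (edgeSideEnumeration G) a₀ b₀)))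
      by-cases (no y≢a₀) (no y≢b₀) = trans (whiteStep-elsewhere y y≢a₀ y≢b₀)
        (cong (whiteStep s′) (sym (transpose-other (edgeSideEnumeration G) a₀ b₀ y≢a₀ y≢b₀)))

    numClasses-whitenAt : numClasses (whiteOrbits s penrose) ≡ suc (numClasses (whiteOrbits s′ penrose′)) ⊎
                          numClasses (whiteOrbits s′ penrose′) ≡ suc (numClasses (whiteOrbits s penrose))
    numClasses-whitenAt = numClasses-transposition (edgeSideEnumeration G) (whiteStep s′) (whiteStep s)
                            (whiteStep-injective s′ penrose′) a₀ b₀ a₀≢b₀ whiteStep-transpose

  crossings-curves-parity : ∀ m s (penrose : Penrose G s) → numCross G s ≡ m →
    (numCross G s + numClasses (whiteOrbits s penrose)) % 2 ≡ numClasses (faceOrbits G) % 2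
  crossings-curves-parity zero s penrose no-crossing = begin
    (numCross G s + numClasses (whiteOrbits s penrose)) % 2  ≡⟨ cong (λ c → (c + numClasses (whiteOrbits s penrose)) % 2) no-crossing ⟩
    numClasses (whiteOrbits s penrose) % 2                   ≡⟨ cong (_% 2) (numFaces-whiteOrbits s all-white) ⟨
    numClasses (faceOrbits G) % 2                            ∎
    where
    open ≡-Reasoning
    all-white : ∀ e → s e ≡ white
    all-white e = white-state (s e) (penrose e)
                    (count≡0⇒¬ (isCross ∘ s) (trans (sym (numCross-count G s)) no-crossing) e)
  crossings-curves-parity (suc m) s penrose crossings
    with count≡suc⇒∃ (isCross ∘ s) (trans (sym (numCross-count G s)) crossings)
  ... | e₀ , e₀-cross = begin
    (numCross G s + numClasses (whiteOrbits s penrose)) % 2    ≡⟨ parity-switch fewer-crossings (numClasses-whitenAt s penrose e₀ crossing) ⟩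
    (numCross G s′ + numClasses (whiteOrbits s′ penrose′)) % 2 ≡⟨ crossings-curves-parity m s′ penrose′ (suc-injective (trans (sym fewer-crossings) crossings)) ⟩
    numClasses (faceOrbits G) % 2                              ∎
    where
    open ≡-Reasoning
    crossing = cross-state (s e₀) e₀-cross
    s′ = whitenAt G e₀ s
    penrose′ = whitenAt-penrose G e₀ s penrose
    fewer-crossings = numCross-whitenAt G e₀ s crossing

%-+-congˡ : ∀ a b c → a % 2 ≡ b % 2 → (a + c) % 2 ≡ (b + c) % 2
%-+-congˡ a b c eq = begin
  (a + c) % 2                ≡⟨ %-distribˡ-+ a c 2 ⟩
  (a % 2 + c % 2) % 2        ≡⟨ cong (λ r → (r + c % 2) % 2) eq ⟩
  (b % 2 + c % 2) % 2        ≡⟨ %-distribˡ-+ b c 2 ⟨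
  (b + c) % 2                ∎
  where open ≡-Reasoning

lemma6p1 : (G : OrientableEmbeddedGraph) → CheckerboardColourable G →
           (s : GState G) → Penrose G s →
           (numCross G s + numCurves G s) % 2 ≡ numFaces G % 2
lemma6p1 G (col , col-φ , col-α) s penrose = begin
  (numCross G s + numCurves G s) % 2                   ≡⟨ cong (λ k → (numCross G s + k) % 2) (numCurves-stateClasses G s) ⟩
  (numCross G s + (curves + nIso G)) % 2               ≡⟨ cong (_% 2) (+-assoc (numCross G s) curves (nIso G)) ⟨
  (numCross G s + curves + nIso G) % 2                 ≡⟨ cong (λ k → (numCross G s + k + nIso G) % 2) (numCurves-whiteOrbits s penrose) ⟩
  (numCross G s + numClasses (whiteOrbits s penrose) + nIso G) % 2
                                                       ≡⟨ %-+-congˡ (numCross G s + numClasses (whiteOrbits s penrose)) (numClasses (faceOrbits G)) (nIso G) parity ⟩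
  (numClasses (faceOrbits G) + nIso G) % 2             ≡⟨ cong (_% 2) (numFaces-faceOrbits G) ⟨
  numFaces G % 2                                       ∎
  where
  open ≡-Reasoning
  open Checkerboard G col col-φ col-α
  curves = numClasses (StateCurves.classPartition G s)
  parity : (numCross G s + numClasses (whiteOrbits s penrose)) % 2 ≡ numClasses (faceOrbits G) % 2
  parity = crossings-curves-parity (numCross G s) s penrose refl
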